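{- For all integers $r,s\ge 1$, $\chi_{la}(rDF(2s))=3$.
   Context: For a graph $G=(V,E)$ with $|E|=m$ and no isolated vertices, a local antimagic labeling is a bijection $f:E\to\{1,\dots,m\}$ such that $f^+(u)\ne f^+(v)$ for every edge $uv$, where $f^+(x)=\sum f(e)$ over all edges $e$ incident to $x$. The local antimagic chromatic number $\chi_{la}(G)$ is the minimum, over all local antimagic labelings $f$ of $G$, of the number of distinct values taken by $f^+$ (also for disconnected graphs). $rG$ is the disjoint union of $r$ copies of $G$. For $s\ge 1$, let $S_1,S_2$ be two disjoint copies of $sP_3$ (the disjoint union of $s$ paths on 3 vertices). The diamond fan $DF(2s)$ is obtained from $S_1+S_2$ by adding a vertex $y$ adjacent to every degree-1 vertex of $S_1$ and every degree-2 vertex of $S_2$, and a vertex $z$ adjacent to every degree-1 vertex of $S_2$ and every degree-2 vertex of $S_1$. -}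

module Defs where

open import Data.Nat using (ℕ; zero; suc; _+_; _*_; _≤_; _≟_)
open import Data.Fin using (Fin; toℕ)
open import Data.Fin.Permutation using (Permutation′; _⟨$⟩ʳ_)
open import Data.List using (List; []; _∷_; map; concatMap; upTo; length; allFin; lookup; deduplicate)
open import Data.Product using (_×_; _,_; proj₁; proj₂; Σ; ∃)
open import Data.Bool using (if_then_else_; _∨_)
open import Data.Nat.ListAction using (sum)
open import Relation.Nullary using (¬_)
open import Relation.Nullary.Decidable using (⌊_⌋)
open import Relation.Binary.PropositionalEquality using (_≡_; _≢_)

-- A graph without isolated vertices, given by its list of edges
-- (vertices are natural numbers; the vertex set is the set of endpoints).
Graph : Set
Graph = List (ℕ × ℕ)

numEdges : Graph → ℕ
numEdges G = length G

-- A bijection f : E → {1..m}; edge with index e gets label 1 + toℕ (π e).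
Labeling : Graph → Set
Labeling G = Permutation′ (numEdges G)

label : (G : Graph) → Labeling G → Fin (numEdges G) → ℕ
label G π e = suc (toℕ (π ⟨$⟩ʳ e))

incident : ℕ → ℕ × ℕ → Data.Bool.Bool
incident v (a , b) = ⌊ v ≟ a ⌋ ∨ ⌊ v ≟ b ⌋

vsum : (G : Graph) → Labeling G → ℕ → ℕ
vsum G π v = sum (map (λ e → if incident v (lookup G e) then label G π e else 0) (allFin (numEdges G)))

IsLocalAntimagic : (G : Graph) → Labeling G → Set
IsLocalAntimagic G π = ∀ e → vsum G π (proj₁ (lookup G e)) ≢ vsum G π (proj₂ (lookup G e))

vertices : Graph → List ℕ
vertices G = concatMap (λ p → proj₁ p ∷ proj₂ p ∷ []) G

numColours : (G : Graph) → Labeling G → ℕ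
numColours G π = length (deduplicate _≟_ (map (vsum G π) (vertices G)))

χla≡ : Graph → ℕ → Set
χla≡ G k =
  (Σ (Labeling G) λ π → IsLocalAntimagic G π × numColours G π ≡ k)
  × (∀ (π : Labeling G) → IsLocalAntimagic G π → k ≤ numColours G π)

-- For i < s: S₁ path a_i - b_i - c_i with
-- a_i = 6i, b_i = 6i+1, c_i = 6i+2; S₂ path d_i - e_i - g_i with
-- d_i = 6i+3, e_i = 6i+4, g_i = 6i+5; y = 6s, z = 6s+1.
-- y ~ a_i, c_i (deg-1 of S₁), e_i (deg-2 of S₂);
-- z ~ d_i, g_i (deg-1 of S₂), b_i (deg-2 of S₁).
DF : ℕ → Graph
DF s = concatMap block (upTo s)
  where
  y = 6 * s
  z = 6 * s + 1
  block : ℕ → Graph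
  block i =
    let a = 6 * i ; b = 6 * i + 1 ; c = 6 * i + 2
        d = 6 * i + 3 ; e = 6 * i + 4 ; g = 6 * i + 5
    in (a , b) ∷ (b , c) ∷ (d , e) ∷ (e , g)
       ∷ (y , a) ∷ (y , c) ∷ (y , e)
       ∷ (z , d) ∷ (z , g) ∷ (z , b) ∷ []

shift : ℕ → ℕ × ℕ → ℕ × ℕ
shift k (u , v) = (k + u , k + v)

-- r disjoint copies of DF(2s); copy k uses vertices k(6s+2) .. k(6s+2)+6s+1
rDF : ℕ → ℕ → Graph
rDF r s = concatMap (λ k → map (shift (k * (6 * s + 2))) (DF s)) (upTo r)

-- Lower bound: each copy of DF(2s) is bipartite with parts {aᵢ, cᵢ, eᵢ, z} and {bᵢ, dᵢ, gᵢ, y}, both of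
-- size 3s + 1, so the vertex sums over either part add up to the total label of the copy. A local
-- antimagic labelling with at most two colours properly 2-colours the connected copy, hence is
-- constant on each part, with values X ≠ Y; but then (3s + 1) X = (3s + 1) Y.
--
-- Upper bound: number the N = rs blocks (the i-th P₃ of S₁ with the i-th P₃ of S₂, over all copies)
-- by j < N and label the ten edges of block j by affine functions of j and N - 1 - j whose values
-- tile {1, …, 10N}. The vertex sums are then 8N + 1 at a, c, d, g, 14N + 2 at b, e and s (20N + 1)
-- at the hubs.

module Submission where

open import Defs
open import Data.Bool using (Bool; false; if_then_else_; _∨_; T)
open import Data.Empty using (⊥-elim)
open import Data.Fin using (Fin; zero; suc; toℕ; fromℕ<; cast; combine; remQuot; opposite; _↑ˡ_; _↑ʳ_; punchIn)
open import Data.Fin.Patterns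
import Data.Fin.Properties as Fin
open import Data.Fin.Permutation using (cast-id; _⟨$⟩ʳ_)
open import Data.List
  using (List; []; _∷_; _++_; map; concat; concatMap; upTo; applyUpTo; length; lookup; tabulate; deduplicate)
open import Data.List.Properties
  using (map-tabulate; map-applyUpTo; concat-map; tabulate-cong; length-tabulate; lookup-tabulate; concat-concat)
open import Data.List.Membership.Propositional using (_∈_)
open import Data.List.Membership.Propositional.Properties using (∈-map⁺; ∈-deduplicate⁺; ∈-lookup; ∈-concat⁺′)
open import Data.List.Relation.Unary.All as All using (All; []; _∷_)
import Data.List.Relation.Unary.All.Properties as All
open import Data.List.Relation.Unary.AllPairs using ([]; _∷_)
open import Data.List.Relation.Unary.Any using (here; there)
open import Data.List.Relation.Unary.Unique.Propositional using (Unique)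
open import Data.List.Relation.Unary.Unique.DecPropositional.Properties using (deduplicate-!)
open import Data.Nat using (ℕ; zero; suc; _+_; _*_; _∸_; _≤_; _<_; _≤ᵇ_; _<ᵇ_; z≤n; s≤s; z<s; _≟_)
open import Data.Nat.ListAction using (sum)
open import Data.Nat.Properties
open import Data.Nat.Tactic.RingSolver using (solve-∀; solve)
open import Algebra.Properties.CommutativeMonoid.Sum +-0-commutativeMonoid
  using (sum-syntax; sum-cong-≗; sum-remove; ∑-distrib-+)
open import Data.Product using (_×_; _,_; proj₁; proj₂; map₁; uncurry; ∃-syntax)
open import Data.Product.Algebra using (×-comm)
open import Function using (_∘_; _∋_; id; _⇔_; mk⇔; _↔_; mk↔ₛ′; Inverse)
open import Function.Construct.Composition using (_↔-∘_)
open import Function.Construct.Symmetry using (↔-sym)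
open import Relation.Nullary using (¬_; yes; no)
open import Relation.Nullary.Decidable using (Dec; ⌊_⌋; isYes≗does; does-⇔; dec-false)
open import Relation.Binary.PropositionalEquality

∑-tabulate : ∀ {n} (f : Fin n → ℕ) → sum (tabulate f) ≡ ∑[ i < n ] f i
∑-tabulate {zero} f = refl
∑-tabulate {suc n} f = cong (f zero +_) (∑-tabulate (f ∘ suc))

∑-cast : ∀ {m n} (m≡n : m ≡ n) (f : Fin n → ℕ) → ∑[ i < n ] f i ≡ ∑[ i < m ] f (cast m≡n i)
∑-cast refl f = sum-cong-≗ (λ i → cong f (sym (Fin.cast-is-id refl i)))

∑-↑ : ∀ m {n} (f : Fin (m + n) → ℕ) →
      ∑[ x < m + n ] f x ≡ ∑[ i < m ] f (i ↑ˡ n) + ∑[ j < n ] f (m ↑ʳ j)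
∑-↑ zero f = refl
∑-↑ (suc m) f = trans (cong (f zero +_) (∑-↑ m (f ∘ suc))) (sym (+-assoc (f zero) _ _))

∑-combine : ∀ m {n} (f : Fin (m * n) → ℕ) → ∑[ x < m * n ] f x ≡ ∑[ a < m ] ∑[ b < n ] f (combine a b)
∑-combine zero f = refl
∑-combine (suc m) {n} f = trans (∑-↑ n f) (cong (∑[ b < n ] f (b ↑ˡ m * n) +_) (∑-combine m (f ∘ (n ↑ʳ_))))

∑-zero : ∀ {n} (f : Fin n → ℕ) → (∀ i → f i ≡ 0) → ∑[ i < n ] f i ≡ 0
∑-zero {zero} f f≡0 = refl
∑-zero {suc n} f f≡0 = cong₂ _+_ (f≡0 zero) (∑-zero (f ∘ suc) (f≡0 ∘ suc))

∑-const : ∀ {n} (f : Fin n → ℕ) {c} → (∀ i → f i ≡ c) → ∑[ i < n ] f i ≡ n * c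
∑-const {zero} f f≡c = refl
∑-const {suc n} f f≡c = cong₂ _+_ (f≡c zero) (∑-const (f ∘ suc) (f≡c ∘ suc))

∑-single : ∀ {n} (f : Fin n → ℕ) (i : Fin n) → (∀ j → j ≢ i → f j ≡ 0) → ∑[ j < n ] f j ≡ f i
∑-single {suc n} f i others≡0 = begin
  ∑[ j < suc n ] f j                ≡⟨ sum-remove f ⟩
  f i + ∑[ j < n ] f (punchIn i j)  ≡⟨ cong (f i +_) (∑-zero _ (λ j → others≡0 _ (Fin.punchInᵢ≢i i j))) ⟩
  f i + 0                           ≡⟨ +-identityʳ (f i) ⟩
  f i                               ∎
  where open ≡-Reasoning

applyUpTo-tabulate : ∀ {A : Set} (f : ℕ → A) n → applyUpTo f n ≡ tabulate {n = n} (f ∘ toℕ)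
applyUpTo-tabulate f zero = refl
applyUpTo-tabulate f (suc n) = cong (f 0 ∷_) (applyUpTo-tabulate (f ∘ suc) n)

concatMap-upTo : ∀ {A : Set} (f : ℕ → List A) n → concatMap f (upTo n) ≡ concat (tabulate {n = n} (f ∘ toℕ))
concatMap-upTo f n = cong concat (trans (map-applyUpTo id f n) (applyUpTo-tabulate f n))

tabulate-↑ : ∀ {A : Set} m {n} (f : Fin (m + n) → A) →
             tabulate f ≡ tabulate (f ∘ (_↑ˡ n)) ++ tabulate (f ∘ (m ↑ʳ_))
tabulate-↑ zero f = refl
tabulate-↑ (suc m) f = cong (f zero ∷_) (tabulate-↑ m (f ∘ suc))

tabulate-combine : ∀ {A : Set} m {n} (f : Fin (m * n) → A) →
  tabulate f ≡ concat (tabulate {n = m} (λ a → tabulate {n = n} (λ b → f (combine a b))))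
tabulate-combine zero f = refl
tabulate-combine (suc m) {n} f =
  trans (tabulate-↑ n f) (cong (tabulate (f ∘ (_↑ˡ m * n)) ++_) (tabulate-combine m (f ∘ (n ↑ʳ_))))

private
  remove : ∀ {A : Set} {x : A} {ys} → x ∈ ys →
           ∃[ zs ] length ys ≡ suc (length zs) × (∀ {z} → z ∈ ys → z ≢ x → z ∈ zs)
  remove {ys = y ∷ ys} (here refl) =
    ys , refl , λ { (here z≡x) z≢x → ⊥-elim (z≢x z≡x) ; (there z∈ys) _ → z∈ys }
  remove {ys = y ∷ ys} (there x∈ys) with remove x∈ys
  ... | zs , |ys|≡ , keep =
    y ∷ zs , cong suc |ys|≡ , λ { (here z≡y) _ → here z≡y ; (there z∈ys) z≢x → there (keep z∈ys z≢x) }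

Unique⊆⇒length≤ : ∀ {A : Set} {xs ys : List A} → Unique xs → All (_∈ ys) xs → length xs ≤ length ys
Unique⊆⇒length≤ [] [] = z≤n
Unique⊆⇒length≤ (x≢xs ∷ unique) (x∈ys ∷ xs⊆ys) with remove x∈ys
... | zs , |ys|≡ , keep = subst (_ ≤_) (sym |ys|≡)
  (s≤s (Unique⊆⇒length≤ unique (All.zipWith (λ (z∈ys , x≢z) → keep z∈ys (x≢z ∘ sym)) (xs⊆ys , x≢xs))))

module _ {A : Set} {m n : ℕ} (encode : Fin m → A ↔ Fin n) where
  private
    module Enc c = Inverse (encode c)

    to : Fin m × A → Fin (m * n)
    to (c , a) = combine c (Enc.to c a)

    from : Fin (m * n) → Fin m × A
    from y = let (c , w) = remQuot n y in c , Enc.from c w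

    to∘from : ∀ y → to (from y) ≡ y
    to∘from y = let (c , w) = remQuot n y in
      trans (cong (combine c) (Enc.strictlyInverseˡ c w)) (Fin.combine-remQuot {m} n y)

    from∘to : ∀ p → from (to p) ≡ p
    from∘to (c , a) = trans (cong (λ (c , w) → c , Enc.from c w) (Fin.remQuot-combine c (Enc.to c a)))
                            (cong (c ,_) (Enc.strictlyInverseʳ c a))

  combine-↔ : (Fin m × A) ↔ Fin (m * n)
  combine-↔ = mk↔ₛ′ to from to∘from from∘to

  toℕ-combine-↔ : ∀ c a → toℕ (Inverse.to combine-↔ (c , a)) ≡ n * toℕ c + toℕ (Enc.to c a)
  toℕ-combine-↔ c a = Fin.toℕ-combine c (Enc.to c a)

stacking : ∀ {N} → (Fin 2 × Fin N) ↔ Fin (2 * N)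
stacking = ↔-sym Fin.*↔×

interleaving : ∀ {N} → (Fin 2 × Fin N) ↔ Fin (2 * N)
interleaving {N} = cast-id (*-comm N 2) ↔-∘ (↔-sym Fin.*↔× ↔-∘ ×-comm (Fin 2) (Fin N))

toℕ-stacking : ∀ {N} h (x : Fin N) → toℕ (Inverse.to stacking (h , x)) ≡ N * toℕ h + toℕ x
toℕ-stacking h x = Fin.toℕ-combine h x

toℕ-interleaving : ∀ {N} h (x : Fin N) → toℕ (Inverse.to interleaving (h , x)) ≡ 2 * toℕ x + toℕ h
toℕ-interleaving {N} h x = trans (Fin.toℕ-cast (*-comm N 2) (combine x h)) (Fin.toℕ-combine x h)

opposite-sum : ∀ {N} (j : Fin N) → suc (toℕ j + toℕ (opposite j)) ≡ N
opposite-sum {N} j = trans (cong (λ b → suc (toℕ j + b)) (Fin.opposite-prop j)) (m+[n∸m]≡n (Fin.toℕ<n j))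

*-+-injective : ∀ M a b {u v} → u < M → v < M → a * M + u ≡ b * M + v → a ≡ b × u ≡ v
*-+-injective M zero zero u<M v<M eq = refl , eq
*-+-injective M zero (suc b) {u} {v} u<M v<M eq =
  ⊥-elim (<⇒≢ (≤-trans u<M (m≤m+n M (b * M + v))) (trans eq (+-assoc M (b * M) v)))
*-+-injective M (suc a) zero {u} {v} u<M v<M eq =
  ⊥-elim (<⇒≢ (≤-trans v<M (m≤m+n M (a * M + u))) (trans (sym eq) (+-assoc M (a * M) u)))
*-+-injective M (suc a) (suc b) {u} {v} u<M v<M eq
  with a≡b , u≡v ← *-+-injective M a b u<M v<M
                     (+-cancelˡ-≡ M _ _ (trans (sym (+-assoc M (a * M) u)) (trans eq (+-assoc M (b * M) v))))
  = cong suc a≡b , u≡v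

3s+1-cancel : ∀ s {x y} → s * (x + x + x) + x ≡ s * (y + y + y) + y → x ≡ y
3s+1-cancel s {x} {y} eq = *-cancelˡ-≡ x y (suc (s * 3)) (trans (sym (expand s x)) (trans eq (expand s y)))
  where
  expand : ∀ s x → s * (x + x + x) + x ≡ suc (s * 3) * x
  expand = solve-∀

8n+1<14n+2 : ∀ n → 8 * n + 1 < 14 * n + 2
8n+1<14n+2 n = subst (8 * n + 1 <_) (sym (split n)) (m<m+n (8 * n + 1) z<s)
  where
  split : ∀ n → 14 * n + 2 ≡ (8 * n + 1) + suc (6 * n)
  split = solve-∀

14n+2<s[20n+1] : ∀ {n s} → 1 ≤ n → 1 ≤ s → 14 * n + 2 < s * (20 * n + 1)
14n+2<s[20n+1] {suc n} {suc s} _ _ = begin-strict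
  14 * suc n + 2                         <⟨ m<m+n (14 * suc n + 2) z<s ⟩
  14 * suc n + 2 + suc (6 * n + 4)       ≡⟨ split n ⟨
  20 * suc n + 1                         ≤⟨ m≤m+n (20 * suc n + 1) (s * (20 * suc n + 1)) ⟩
  suc s * (20 * suc n + 1)               ∎
  where
  open ≤-Reasoning
  split : ∀ n → 20 * suc n + 1 ≡ 14 * suc n + 2 + suc (6 * n + 4)
  split = solve-∀

⌊⌋-⇔ : ∀ {A B : Set} → A ⇔ B → (a? : Dec A) (b? : Dec B) → ⌊ a? ⌋ ≡ ⌊ b? ⌋
⌊⌋-⇔ A⇔B a? b? = trans (isYes≗does a?) (trans (does-⇔ A⇔B a? b?) (sym (isYes≗does b?)))

⌊⌋-false : ∀ {A : Set} (a? : Dec A) → ¬ A → ⌊ a? ⌋ ≡ false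
⌊⌋-false a? ¬a = trans (isYes≗does a?) (dec-false a? ¬a)

incidentLabel : ℕ → ℕ × ℕ → ℕ → ℕ
incidentLabel v e l = if incident v e then l else 0

vsum-∑ : ∀ G π v → vsum G π v ≡ ∑[ e < numEdges G ] incidentLabel v (lookup G e) (label G π e)
vsum-∑ G π v = trans (cong sum (map-tabulate id h)) (∑-tabulate h)
  where
  h : Fin (numEdges G) → ℕ
  h e = incidentLabel v (lookup G e) (label G π e)

module _ {n} {E : Fin n → ℕ × ℕ} {G : Graph} where

  numEdges-tabulate : G ≡ tabulate E → n ≡ numEdges G
  numEdges-tabulate refl = sym (length-tabulate E)

  lookup-tabulated : (G≡E : G ≡ tabulate E) (x : Fin n) → lookup G (cast (numEdges-tabulate G≡E) x) ≡ E x
  lookup-tabulated refl = lookup-tabulate E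

  vsum-tabulated : (G≡E : G ≡ tabulate E) (π : Labeling G) (v : ℕ) →
    vsum G π v ≡ ∑[ x < n ] incidentLabel v (E x) (label G π (cast (numEdges-tabulate G≡E) x))
  vsum-tabulated G≡E π v = begin
    vsum G π v                                                      ≡⟨ vsum-∑ G π v ⟩
    ∑[ e < numEdges G ] incidentLabel v (lookup G e) (label G π e)  ≡⟨ ∑-cast (numEdges-tabulate G≡E) _ ⟩
    ∑[ x < n ] incidentLabel v (lookup G (ι x)) (label G π (ι x))   ≡⟨ sum-cong-≗ (λ x →
                                                                         cong (λ e → incidentLabel v e (label G π (ι x)))
                                                                              (lookup-tabulated G≡E x)) ⟩
    ∑[ x < n ] incidentLabel v (E x) (label G π (ι x))              ∎
    where
    open ≡-Reasoning
    ι : Fin n → Fin (numEdges G)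
    ι = cast (numEdges-tabulate G≡E)

∈-vertices₁ : ∀ {G : Graph} {e} → e ∈ G → proj₁ e ∈ vertices G
∈-vertices₁ e∈G = ∈-concat⁺′ (here refl) (∈-map⁺ _ e∈G)

∈-vertices₂ : ∀ {G : Graph} {e} → e ∈ G → proj₂ e ∈ vertices G
∈-vertices₂ e∈G = ∈-concat⁺′ (there (here refl)) (∈-map⁺ _ e∈G)

All-vertices : ∀ {P : ℕ → Set} {G : Graph} → All (λ e → P (proj₁ e) × P (proj₂ e)) G → All P (vertices G)
All-vertices = All.concat⁺ ∘ All.map⁺ ∘ All.map (λ (p₁ , p₂) → p₁ ∷ p₂ ∷ [])

All⇒IsLocalAntimagic : ∀ G π → All (λ e → vsum G π (proj₁ e) ≢ vsum G π (proj₂ e)) G →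
                       IsLocalAntimagic G π
All⇒IsLocalAntimagic G π proper e = All.lookup proper (∈-lookup e)

numColours≤ : ∀ G π (cs : List ℕ) → All (λ v → vsum G π v ∈ cs) (vertices G) → numColours G π ≤ length cs
numColours≤ G π cs colours = Unique⊆⇒length≤ (deduplicate-! _≟_ _) (All.deduplicate⁺ _≟_ (All.map⁺ colours))

module _ (G : Graph) (π : Labeling G) {u v w : ℕ}
         (u∈ : u ∈ vertices G) (v∈ : v ∈ vertices G) (w∈ : w ∈ vertices G) where

  private
    f : ℕ → ℕ
    f = vsum G π
    ∈-colours : ∀ {x} → x ∈ vertices G → f x ∈ deduplicate _≟_ (map f (vertices G))
    ∈-colours = ∈-deduplicate⁺ _≟_ ∘ ∈-map⁺ f

  3-distinct⇒3≤numColours : f u ≢ f v → f v ≢ f w → f u ≢ f w → 3 ≤ numColours G π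
  3-distinct⇒3≤numColours u≢v v≢w u≢w = Unique⊆⇒length≤
    ((u≢v ∷ u≢w ∷ []) ∷ (v≢w ∷ []) ∷ [] ∷ [])
    (∈-colours u∈ ∷ ∈-colours v∈ ∷ ∈-colours w∈ ∷ [])

  numColours<3⇒≡ : numColours G π < 3 → f u ≢ f v → f v ≢ f w → f u ≡ f w
  numColours<3⇒≡ few u≢v v≢w with f u ≟ f w
  ... | yes u≡w = u≡w
  ... | no u≢w = ⊥-elim (<⇒≱ few (3-distinct⇒3≤numColours u≢v v≢w u≢w))

-- Vertices of block i of a copy, numbered as in DF: 0F … 5F are a, b, c, d, e, g and 6F, 7F the hubs y, z.
localVertex : ℕ → ℕ → Fin 8 → ℕ
localVertex s i 0F = 6 * i
localVertex s i 1F = 6 * i + 1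
localVertex s i 2F = 6 * i + 2
localVertex s i 3F = 6 * i + 3
localVertex s i 4F = 6 * i + 4
localVertex s i 5F = 6 * i + 5
localVertex s i 6F = 6 * s
localVertex s i 7F = 6 * s + 1

-- The ten edges of a block in the order of DF: ab, bc, de, eg, ya, yc, ye, zd, zg, zb.
end₁ end₂ : Fin 10 → Fin 8
end₁ 0F = 0F
end₁ 1F = 1F
end₁ 2F = 3F
end₁ 3F = 4F
end₁ 4F = 6F
end₁ 5F = 6F
end₁ 6F = 6F
end₁ 7F = 7F
end₁ 8F = 7F
end₁ 9F = 7F
end₂ 0F = 1F
end₂ 1F = 2F
end₂ 2F = 4F
end₂ 3F = 5F
end₂ 4F = 0F
end₂ 5F = 2F
end₂ 6F = 4F
end₂ 7F = 3F
end₂ 8F = 5F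
end₂ 9F = 1F

localEdge : ∀ {s} → ℕ → Fin 10 → ℕ × ℕ
localEdge {s} i t = localVertex s i (end₁ t) , localVertex s i (end₂ t)

data LocalVertexView : Fin 8 → Set where
  path : ∀ {x} → toℕ x < 6 → (∀ s i → localVertex s i x ≡ 6 * i + toℕ x) → LocalVertexView x
  hub  : ∀ {x} → 6 ≤ toℕ x → (∀ s i → localVertex s i x ≡ 6 * s + (toℕ x ∸ 6)) → LocalVertexView x

localVertex-view : ∀ x → LocalVertexView x
localVertex-view 0F = path (<ᵇ⇒< _ _ _) (λ s i → sym (+-identityʳ (6 * i)))
localVertex-view 1F = path (<ᵇ⇒< _ _ _) (λ s i → refl)
localVertex-view 2F = path (<ᵇ⇒< _ _ _) (λ s i → refl)
localVertex-view 3F = path (<ᵇ⇒< _ _ _) (λ s i → refl)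
localVertex-view 4F = path (<ᵇ⇒< _ _ _) (λ s i → refl)
localVertex-view 5F = path (<ᵇ⇒< _ _ _) (λ s i → refl)
localVertex-view 6F = hub ≤-refl (λ s i → sym (+-identityʳ (6 * s)))
localVertex-view 7F = hub (n≤1+n 6) (λ s i → refl)

path<hub : ∀ {s i p} → i < s → p < 6 → 6 * i + p < 6 * s
path<hub {s} {i} {p} i<s p<6 = begin-strict
  6 * i + p   <⟨ +-monoʳ-< (6 * i) p<6 ⟩
  6 * i + 6   ≡⟨ +-comm (6 * i) 6 ⟩
  6 + 6 * i   ≡⟨ *-suc 6 i ⟨
  6 * suc i   ≤⟨ *-monoʳ-≤ 6 i<s ⟩
  6 * s       ∎
  where open ≤-Reasoning

localVertex<6s+2 : ∀ {s i} x → i < s → localVertex s i x < 6 * s + 2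
localVertex<6s+2 {s} {i} x i<s with localVertex-view x
... | path x<6 lv≡ rewrite lv≡ s i = ≤-trans (path<hub i<s x<6) (m≤m+n (6 * s) 2)
... | hub 6≤x lv≡ rewrite lv≡ s i = +-monoʳ-< (6 * s) (∸-monoˡ-< (Fin.toℕ<n x) 6≤x)

localVertex-hub : ∀ {s} i i' {x} → 6 ≤ toℕ x → localVertex s i x ≡ localVertex s i' x
localVertex-hub {s} i i' {x} 6≤x with localVertex-view x
... | path x<6 _ = ⊥-elim (<⇒≱ x<6 6≤x)
... | hub _ lv≡ = trans (lv≡ s i) (sym (lv≡ s i'))

localVertex-injective : ∀ {s i i'} x x' → i < s → i' < s → localVertex s i x ≡ localVertex s i' x' →
                        x ≡ x' × (toℕ x < 6 → i ≡ i')
localVertex-injective {s} {i} {i'} x x' i<s i'<s eq with localVertex-view x | localVertex-view x'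
... | path x<6 lv≡ | path x'<6 lv'≡
  with i≡i' , x≡x' ← *-+-injective 6 i i' x<6 x'<6
         (subst₂ (λ a b → a + toℕ x ≡ b + toℕ x') (*-comm 6 i) (*-comm 6 i')
                 (trans (sym (lv≡ s i)) (trans eq (lv'≡ s i'))))
  = Fin.toℕ-injective x≡x' , λ _ → i≡i'
... | path x<6 lv≡ | hub _ lv'≡ =
  ⊥-elim (<⇒≢ (≤-trans (path<hub i<s x<6) (m≤m+n (6 * s) _))
              (trans (sym (lv≡ s i)) (trans eq (lv'≡ s i'))))
... | hub _ lv≡ | path x'<6 lv'≡ =
  ⊥-elim (<⇒≢ (≤-trans (path<hub i'<s x'<6) (m≤m+n (6 * s) _))
              (trans (sym (lv'≡ s i')) (trans (sym eq) (lv≡ s i))))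
... | hub 6≤x lv≡ | hub 6≤x' lv'≡ =
  Fin.toℕ-injective (∸-cancelʳ-≡ 6≤x 6≤x' (+-cancelˡ-≡ (6 * s) _ _
                                               (trans (sym (lv≡ s i)) (trans eq (lv'≡ s i'))))) ,
  λ x<6 → ⊥-elim (<⇒≱ x<6 6≤x)

isEnd : Fin 8 → Fin 10 → Bool
isEnd x t = ⌊ x Fin.≟ end₁ t ⌋ ∨ ⌊ x Fin.≟ end₂ t ⌋

localSum : (Fin 10 → ℕ) → Fin 8 → ℕ
localSum ℓ x = ∑[ t < 10 ] (if isEnd x t then ℓ t else 0)

-- Every edge of a block joins {a, c, e, z} to {b, d, g, y}.
localSum-bipartite : ∀ ℓ → localSum ℓ 0F + localSum ℓ 2F + localSum ℓ 4F + localSum ℓ 7F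
                         ≡ localSum ℓ 1F + localSum ℓ 3F + localSum ℓ 5F + localSum ℓ 6F
localSum-bipartite ℓ = identity (ℓ 0F) (ℓ 1F) (ℓ 2F) (ℓ 3F) (ℓ 4F) (ℓ 5F) (ℓ 6F) (ℓ 7F) (ℓ 8F) (ℓ 9F)
  where
  identity : ∀ l₀ l₁ l₂ l₃ l₄ l₅ l₆ l₇ l₈ l₉ →
    (l₀ + (l₄ + 0)) + (l₁ + (l₅ + 0)) + (l₂ + (l₃ + (l₆ + 0))) + (l₇ + (l₈ + (l₉ + 0)))
    ≡ (l₀ + (l₁ + (l₉ + 0))) + (l₂ + (l₇ + 0)) + (l₃ + (l₈ + 0)) + (l₄ + (l₅ + (l₆ + 0)))
  identity = solve-∀

module DiamondFans (r s : ℕ) where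

  vertex : Fin r → Fin s → Fin 8 → ℕ
  vertex k i x = toℕ k * (6 * s + 2) + localVertex s (toℕ i) x

  edge : Fin r → Fin s → Fin 10 → ℕ × ℕ
  edge k i t = vertex k i (end₁ t) , vertex k i (end₂ t)

  copyEdges : Fin r → Graph
  copyEdges k = concat (tabulate {n = s} (λ i → tabulate (edge k i)))

  shift-DF : ∀ k → map (shift (toℕ k * (6 * s + 2))) (DF s) ≡ copyEdges k
  shift-DF k = begin
    map (shift K) (DF s)                                 ≡⟨ cong (map (shift K)) (concatMap-upTo _ s) ⟩
    map (shift K) (concat (tabulate blocks))             ≡⟨ concat-map (tabulate blocks) ⟨
    concat (map (map (shift K)) (tabulate blocks))       ≡⟨ cong concat (map-tabulate blocks (map (shift K))) ⟩
    copyEdges k                                          ∎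
    where
    open ≡-Reasoning
    K : ℕ
    K = toℕ k * (6 * s + 2)
    blocks : Fin s → Graph
    blocks i = tabulate (localEdge {s} (toℕ i))

  rDF-copies : rDF r s ≡ concat (tabulate copyEdges)
  rDF-copies = trans (concatMap-upTo _ r) (cong concat (tabulate-cong shift-DF))

  decode : Fin (r * s * 10) → (Fin r × Fin s) × Fin 10
  decode = map₁ (remQuot s) ∘ remQuot 10

  decode-combine : ∀ k i t → decode (combine (combine k i) t) ≡ ((k , i) , t)
  decode-combine k i t =
    trans (cong (map₁ (remQuot s)) (Fin.remQuot-combine (combine k i) t)) (cong (_, t) (Fin.remQuot-combine k i))

  edgeAt : Fin (r * s * 10) → ℕ × ℕ
  edgeAt = uncurry (uncurry edge) ∘ decode

  edgeAt-combine : ∀ k i t → edgeAt (combine (combine k i) t) ≡ edge k i t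
  edgeAt-combine k i t = cong (uncurry (uncurry edge)) (decode-combine k i t)

  rDF-tabulate : rDF r s ≡ tabulate edgeAt
  rDF-tabulate = begin
    rDF r s                                  ≡⟨ rDF-copies ⟩
    concat (tabulate copyEdges)              ≡⟨ cong concat (tabulate-cong (λ k → cong concat (tabulate-cong (λ i →
                                                  tabulate-cong (λ t → sym (edgeAt-combine k i t)))))) ⟩
    concat (tabulate (concat ∘ byCopy))      ≡⟨ cong concat (map-tabulate byCopy concat) ⟨
    concat (map concat (tabulate byCopy))    ≡⟨ concat-concat (tabulate byCopy) ⟩
    concat (concat (tabulate byCopy))        ≡⟨ cong concat (tabulate-combine r byBlock) ⟨
    concat (tabulate byBlock)                ≡⟨ tabulate-combine (r * s) edgeAt ⟨
    tabulate edgeAt                          ∎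
    where
    open ≡-Reasoning
    byBlock : Fin (r * s) → List (ℕ × ℕ)
    byBlock j = tabulate (λ t → edgeAt (combine j t))
    byCopy : Fin r → List (List (ℕ × ℕ))
    byCopy k = tabulate (λ i → byBlock (combine k i))

  edgeIndex : Fin r → Fin s → Fin 10 → Fin (numEdges (rDF r s))
  edgeIndex k i t = cast (numEdges-tabulate rDF-tabulate) (combine (combine k i) t)

  lookup-edgeIndex : ∀ k i t → lookup (rDF r s) (edgeIndex k i t) ≡ edge k i t
  lookup-edgeIndex k i t = trans (lookup-tabulated rDF-tabulate _) (edgeAt-combine k i t)

  edge-∈ : ∀ k i t → edge k i t ∈ rDF r s
  edge-∈ k i t = subst (_∈ rDF r s) (lookup-edgeIndex k i t) (∈-lookup (edgeIndex k i t))

  vertex-∈ : ∀ k i x → vertex k i x ∈ vertices (rDF r s)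
  vertex-∈ k i 0F = ∈-vertices₁ (edge-∈ k i 0F)
  vertex-∈ k i 1F = ∈-vertices₁ (edge-∈ k i 1F)
  vertex-∈ k i 2F = ∈-vertices₂ (edge-∈ k i 1F)
  vertex-∈ k i 3F = ∈-vertices₁ (edge-∈ k i 2F)
  vertex-∈ k i 4F = ∈-vertices₁ (edge-∈ k i 3F)
  vertex-∈ k i 5F = ∈-vertices₂ (edge-∈ k i 3F)
  vertex-∈ k i 6F = ∈-vertices₁ (edge-∈ k i 4F)
  vertex-∈ k i 7F = ∈-vertices₁ (edge-∈ k i 7F)

  All-edges : ∀ {P : ℕ × ℕ → Set} → (∀ k i t → P (edge k i t)) → All P (rDF r s)
  All-edges {P} p = subst (All P) (sym rDF-tabulate) (All.tabulate⁺ (λ x → let ((k , i) , t) = decode x in p k i t))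

  vertex-injective : ∀ k k' i i' x x' → vertex k i x ≡ vertex k' i' x' →
                     k ≡ k' × x ≡ x' × (toℕ x < 6 → i ≡ i')
  vertex-injective k k' i i' x x' eq
    with k≡k' , local≡ ← *-+-injective (6 * s + 2) (toℕ k) (toℕ k')
                            (localVertex<6s+2 x (Fin.toℕ<n i)) (localVertex<6s+2 x' (Fin.toℕ<n i')) eq
    with x≡x' , same-block ← localVertex-injective x x' (Fin.toℕ<n i) (Fin.toℕ<n i') local≡
    = Fin.toℕ-injective k≡k' , x≡x' , Fin.toℕ-injective ∘ same-block

  vertex-≡⇔ : ∀ k i i' x → localVertex s (toℕ i) x ≡ localVertex s (toℕ i') x →
              ∀ x' → vertex k i x ≡ vertex k i' x' ⇔ x ≡ x'
  vertex-≡⇔ k i i' x same x' =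
    mk⇔ (proj₁ ∘ proj₂ ∘ vertex-injective k k i i' x x') (λ { refl → cong (toℕ k * (6 * s + 2) +_) same })

  incident-edge : ∀ v k i x → (∀ x' → v ≡ vertex k i x' ⇔ x ≡ x') →
                  ∀ t → incident v (edge k i t) ≡ isEnd x t
  incident-edge v k i x v≡⇔ t =
    cong₂ _∨_ (⌊⌋-⇔ (v≡⇔ (end₁ t)) (v ≟ vertex k i (end₁ t)) (x Fin.≟ end₁ t))
              (⌊⌋-⇔ (v≡⇔ (end₂ t)) (v ≟ vertex k i (end₂ t)) (x Fin.≟ end₂ t))

  incident-disjoint : ∀ v k i → (∀ x' → v ≢ vertex k i x') → ∀ t → incident v (edge k i t) ≡ false
  incident-disjoint v k i v≢ t =
    cong₂ _∨_ (⌊⌋-false (v ≟ vertex k i (end₁ t)) (v≢ (end₁ t))) (⌊⌋-false (v ≟ vertex k i (end₂ t)) (v≢ (end₂ t)))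

  module VertexSums (π : Labeling (rDF r s)) where

    ℓ : Fin r → Fin s → Fin 10 → ℕ
    ℓ k i t = label (rDF r s) π (edgeIndex k i t)

    blockSum : ℕ → Fin r → Fin s → ℕ
    blockSum v k i = ∑[ t < 10 ] incidentLabel v (edge k i t) (ℓ k i t)

    vsum-blocks : ∀ v → vsum (rDF r s) π v ≡ ∑[ k < r ] ∑[ i < s ] blockSum v k i
    vsum-blocks v = begin
      vsum (rDF r s) π v
        ≡⟨ vsum-tabulated rDF-tabulate π v ⟩
      ∑[ x < r * s * 10 ] incidentLabel v (edgeAt x) (label (rDF r s) π (cast _ x))
        ≡⟨ trans (∑-combine (r * s) _) (∑-combine r _) ⟩
      ∑[ k < r ] ∑[ i < s ] ∑[ t < 10 ] incidentLabel v (edgeAt (combine (combine k i) t)) (ℓ k i t)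
        ≡⟨ sum-cong-≗ (λ k → sum-cong-≗ (λ i → sum-cong-≗ (λ t →
             cong (λ e → incidentLabel v e (ℓ k i t)) (edgeAt-combine k i t)))) ⟩
      ∑[ k < r ] ∑[ i < s ] blockSum v k i
        ∎
      where open ≡-Reasoning

    blockSum-disjoint : ∀ v k i → (∀ x' → v ≢ vertex k i x') → blockSum v k i ≡ 0
    blockSum-disjoint v k i v≢ =
      ∑-zero _ (λ t → cong (λ b → if b then ℓ k i t else 0) (incident-disjoint v k i v≢ t))

    blockSum-at : ∀ v k i x → (∀ x' → v ≡ vertex k i x' ⇔ x ≡ x') → blockSum v k i ≡ localSum (ℓ k i) x
    blockSum-at v k i x v≡⇔ =
      sum-cong-≗ (λ t → cong (λ b → if b then ℓ k i t else 0) (incident-edge v k i x v≡⇔ t))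

    vsum-copy : ∀ k i x → vsum (rDF r s) π (vertex k i x) ≡ ∑[ i' < s ] blockSum (vertex k i x) k i'
    vsum-copy k i x = trans (vsum-blocks (vertex k i x))
      (∑-single _ k (λ k' k'≢k → ∑-zero _ (λ i' → blockSum-disjoint (vertex k i x) k' i' (λ x' eq →
        k'≢k (sym (proj₁ (vertex-injective k k' i i' x x' eq)))))))

    vsum-path : ∀ k i x → toℕ x < 6 → vsum (rDF r s) π (vertex k i x) ≡ localSum (ℓ k i) x
    vsum-path k i x x<6 = begin
      vsum (rDF r s) π (vertex k i x)            ≡⟨ vsum-copy k i x ⟩
      ∑[ i' < s ] blockSum (vertex k i x) k i'   ≡⟨ ∑-single _ i (λ i' i'≢i →
                                                      blockSum-disjoint (vertex k i x) k i' (λ x' eq →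
                                                        i'≢i (sym (proj₂ (proj₂ (vertex-injective k k i i' x x' eq)) x<6)))) ⟩
      blockSum (vertex k i x) k i                ≡⟨ blockSum-at (vertex k i x) k i x (vertex-≡⇔ k i i x refl) ⟩
      localSum (ℓ k i) x                         ∎
      where open ≡-Reasoning

    vsum-hub : ∀ k i x → 6 ≤ toℕ x → vsum (rDF r s) π (vertex k i x) ≡ ∑[ i' < s ] localSum (ℓ k i') x
    vsum-hub k i x 6≤x = trans (vsum-copy k i x)
      (sum-cong-≗ (λ i' →
        blockSum-at (vertex k i x) k i' x (vertex-≡⇔ k i i' x (localVertex-hub (toℕ i) (toℕ i') 6≤x))))

module LowerBound (r s : ℕ) (π : Labeling (rDF r s)) (antimagic : IsLocalAntimagic (rDF r s) π)
                  (k : Fin r) (i₀ : Fin s) where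
  open DiamondFans r s
  open VertexSums π

  f : Fin s → Fin 8 → ℕ
  f i x = vsum (rDF r s) π (vertex k i x)

  f-proper : ∀ i t → f i (end₁ t) ≢ f i (end₂ t)
  f-proper i t = subst (λ e → vsum (rDF r s) π (proj₁ e) ≢ vsum (rDF r s) π (proj₂ e))
                       (lookup-edgeIndex k i t) (antimagic (edgeIndex k i t))

  X Y : ℕ
  X = f i₀ 0F
  Y = f i₀ 6F

  X≢Y : X ≢ Y
  X≢Y = ≢-sym (f-proper i₀ 4F)

  block-balanced : ∑[ i < s ] (f i 0F + f i 2F + f i 4F) + f i₀ 7F
                 ≡ ∑[ i < s ] (f i 1F + f i 3F + f i 5F) + f i₀ 6F
  block-balanced = begin
    ∑[ i < s ] (f i 0F + f i 2F + f i 4F) + f i₀ 7F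
      ≡⟨ cong₂ _+_ (sum-cong-≗ (λ i → cong₂ _+_ (cong₂ _+_ (f-path i 0F _) (f-path i 2F _)) (f-path i 4F _)))
                   (f-hub 7F _) ⟩
    ∑[ i < s ] (S i 0F + S i 2F + S i 4F) + ∑[ i < s ] S i 7F
      ≡⟨ ∑-distrib-+ (λ i → S i 0F + S i 2F + S i 4F) (λ i → S i 7F) ⟨
    ∑[ i < s ] (S i 0F + S i 2F + S i 4F + S i 7F)
      ≡⟨ sum-cong-≗ (λ i → localSum-bipartite (ℓ k i)) ⟩
    ∑[ i < s ] (S i 1F + S i 3F + S i 5F + S i 6F)
      ≡⟨ ∑-distrib-+ (λ i → S i 1F + S i 3F + S i 5F) (λ i → S i 6F) ⟩
    ∑[ i < s ] (S i 1F + S i 3F + S i 5F) + ∑[ i < s ] S i 6F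
      ≡⟨ cong₂ _+_ (sum-cong-≗ (λ i → cong₂ _+_ (cong₂ _+_ (f-path i 1F _) (f-path i 3F _)) (f-path i 5F _)))
                   (f-hub 6F _) ⟨
    ∑[ i < s ] (f i 1F + f i 3F + f i 5F) + f i₀ 6F
      ∎
    where
    open ≡-Reasoning
    S : Fin s → Fin 8 → ℕ
    S i = localSum (ℓ k i)
    f-path : ∀ i x → T (toℕ x <ᵇ 6) → f i x ≡ S i x
    f-path i x x<6 = vsum-path k i x (<ᵇ⇒< _ _ x<6)
    f-hub : ∀ x → T (6 ≤ᵇ toℕ x) → f i₀ x ≡ ∑[ i < s ] S i x
    f-hub x 6≤x = vsum-hub k i₀ x (≤ᵇ⇒≤ _ _ 6≤x)

  module _ (few : numColours (rDF r s) π < 3) where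

    ≡X : ∀ i x → f i x ≢ Y → f i x ≡ X
    ≡X i x x≢Y =
      numColours<3⇒≡ (rDF r s) π (vertex-∈ k i x) (vertex-∈ k i₀ 6F) (vertex-∈ k i₀ 0F) few x≢Y (≢-sym X≢Y)

    ≡Y : ∀ i x → f i x ≢ X → f i x ≡ Y
    ≡Y i x x≢X =
      numColours<3⇒≡ (rDF r s) π (vertex-∈ k i x) (vertex-∈ k i₀ 0F) (vertex-∈ k i₀ 6F) few x≢X X≢Y

    a≡X : ∀ i → f i 0F ≡ X
    c≡X : ∀ i → f i 2F ≡ X
    e≡X : ∀ i → f i 4F ≡ X
    b≡Y : ∀ i → f i 1F ≡ Y
    d≡Y : ∀ i → f i 3F ≡ Y
    g≡Y : ∀ i → f i 5F ≡ Y
    a≡X i = ≡X i 0F (≢-sym (f-proper i 4F))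
    c≡X i = ≡X i 2F (≢-sym (f-proper i 5F))
    e≡X i = ≡X i 4F (≢-sym (f-proper i 6F))
    b≡Y i = ≡Y i 1F (λ b≡X → f-proper i 0F (trans (a≡X i) (sym b≡X)))
    d≡Y i = ≡Y i 3F (λ d≡X → f-proper i 2F (trans d≡X (sym (e≡X i))))
    g≡Y i = ≡Y i 5F (λ g≡X → f-proper i 3F (trans (e≡X i) (sym g≡X)))

    z≡X : f i₀ 7F ≡ X
    z≡X = ≡X i₀ 7F (λ z≡Y → f-proper i₀ 7F (trans z≡Y (sym (d≡Y i₀))))

    X≡Y : X ≡ Y
    X≡Y = 3s+1-cancel s (begin
      s * (X + X + X) + X
        ≡⟨ cong₂ _+_ (∑-const _ (λ i → cong₂ _+_ (cong₂ _+_ (a≡X i) (c≡X i)) (e≡X i))) z≡X ⟨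
      ∑[ i < s ] (f i 0F + f i 2F + f i 4F) + f i₀ 7F
        ≡⟨ block-balanced ⟩
      ∑[ i < s ] (f i 1F + f i 3F + f i 5F) + f i₀ 6F
        ≡⟨ cong (_+ Y) (∑-const _ (λ i → cong₂ _+_ (cong₂ _+_ (b≡Y i) (d≡Y i)) (g≡Y i))) ⟩
      s * (Y + Y + Y) + Y
        ∎)
      where open ≡-Reasoning

  numColours≥3 : 3 ≤ numColours (rDF r s) π
  numColours≥3 = ≮⇒≥ (λ few → X≢Y (X≡Y few))

-- The vertex sums within a block under UpperBound.labelling, for the block numbered a from one end
-- and b from the other end of the n blocks. The ascription List ℕ ∋ resolves the list constructors,
-- which are overloaded here, for the solver.
a-sum : ∀ n a b → suc (a + b) ≡ n →
  suc (2 * n * 1 + (2 * b + 1)) + (suc (2 * n * 2 + (2 * a + 0)) + 0) ≡ 8 * n + 1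
a-sum .(suc (a + b)) a b refl = solve (List ℕ ∋ a ∷ b ∷ [])

b-sum : ∀ n a b → suc (a + b) ≡ n →
  suc (2 * n * 1 + (2 * b + 1)) + (suc (2 * n * 0 + (n * 1 + a)) + (suc (2 * n * 4 + (n * 1 + a)) + 0)) ≡ 14 * n + 2
b-sum .(suc (a + b)) a b refl = solve (List ℕ ∋ a ∷ b ∷ [])

c-sum : ∀ n a b → suc (a + b) ≡ n →
  suc (2 * n * 0 + (n * 1 + a)) + (suc (2 * n * 3 + (n * 0 + b)) + 0) ≡ 8 * n + 1
c-sum .(suc (a + b)) a b refl = solve (List ℕ ∋ a ∷ b ∷ [])

d-sum : ∀ n a b → suc (a + b) ≡ n →
  suc (2 * n * 0 + (n * 0 + b)) + (suc (2 * n * 3 + (n * 1 + a)) + 0) ≡ 8 * n + 1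
d-sum .(suc (a + b)) a b refl = solve (List ℕ ∋ a ∷ b ∷ [])

e-sum : ∀ n a b → suc (a + b) ≡ n →
  suc (2 * n * 0 + (n * 0 + b)) + (suc (2 * n * 2 + (2 * a + 1)) + (suc (2 * n * 4 + (n * 0 + b)) + 0)) ≡ 14 * n + 2
e-sum .(suc (a + b)) a b refl = solve (List ℕ ∋ a ∷ b ∷ [])

g-sum : ∀ n a b → suc (a + b) ≡ n →
  suc (2 * n * 2 + (2 * a + 1)) + (suc (2 * n * 1 + (2 * b + 0)) + 0) ≡ 8 * n + 1
g-sum .(suc (a + b)) a b refl = solve (List ℕ ∋ a ∷ b ∷ [])

y-sum : ∀ n a b → suc (a + b) ≡ n →
  suc (2 * n * 2 + (2 * a + 0)) + (suc (2 * n * 3 + (n * 0 + b)) + (suc (2 * n * 4 + (n * 0 + b)) + 0)) ≡ 20 * n + 1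
y-sum .(suc (a + b)) a b refl = solve (List ℕ ∋ a ∷ b ∷ [])

z-sum : ∀ n a b → suc (a + b) ≡ n →
  suc (2 * n * 3 + (n * 1 + a)) + (suc (2 * n * 1 + (2 * b + 0)) + (suc (2 * n * 4 + (n * 1 + a)) + 0)) ≡ 20 * n + 1
z-sum .(suc (a + b)) a b refl = solve (List ℕ ∋ a ∷ b ∷ [])

module UpperBound (r s : ℕ) where
  open DiamondFans r s

  N : ℕ
  N = r * s

  private
    σ : Fin N × Fin 10 → Fin 5 × Fin 2 × Fin N
    σ (j , 0F) = 1F , 1F , opposite j
    σ (j , 1F) = 0F , 1F , j
    σ (j , 2F) = 0F , 0F , opposite j
    σ (j , 3F) = 2F , 1F , j
    σ (j , 4F) = 2F , 0F , j
    σ (j , 5F) = 3F , 0F , opposite j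
    σ (j , 6F) = 4F , 0F , opposite j
    σ (j , 7F) = 3F , 1F , j
    σ (j , 8F) = 1F , 0F , opposite j
    σ (j , 9F) = 4F , 1F , j

    σ⁻¹ : Fin 5 × Fin 2 × Fin N → Fin N × Fin 10
    σ⁻¹ (0F , 0F , x) = opposite x , 2F
    σ⁻¹ (0F , 1F , x) = x , 1F
    σ⁻¹ (1F , 0F , x) = opposite x , 8F
    σ⁻¹ (1F , 1F , x) = opposite x , 0F
    σ⁻¹ (2F , 0F , x) = x , 4F
    σ⁻¹ (2F , 1F , x) = x , 3F
    σ⁻¹ (3F , 0F , x) = opposite x , 5F
    σ⁻¹ (3F , 1F , x) = x , 7F
    σ⁻¹ (4F , 0F , x) = opposite x , 6F
    σ⁻¹ (4F , 1F , x) = x , 9F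

    σ∘σ⁻¹ : ∀ p → σ (σ⁻¹ p) ≡ p
    σ∘σ⁻¹ (0F , 0F , x) = cong (λ x → 0F , 0F , x) (Fin.opposite-involutive x)
    σ∘σ⁻¹ (0F , 1F , x) = refl
    σ∘σ⁻¹ (1F , 0F , x) = cong (λ x → 1F , 0F , x) (Fin.opposite-involutive x)
    σ∘σ⁻¹ (1F , 1F , x) = cong (λ x → 1F , 1F , x) (Fin.opposite-involutive x)
    σ∘σ⁻¹ (2F , 0F , x) = refl
    σ∘σ⁻¹ (2F , 1F , x) = refl
    σ∘σ⁻¹ (3F , 0F , x) = cong (λ x → 3F , 0F , x) (Fin.opposite-involutive x)
    σ∘σ⁻¹ (3F , 1F , x) = refl
    σ∘σ⁻¹ (4F , 0F , x) = cong (λ x → 4F , 0F , x) (Fin.opposite-involutive x)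
    σ∘σ⁻¹ (4F , 1F , x) = refl

    σ⁻¹∘σ : ∀ p → σ⁻¹ (σ p) ≡ p
    σ⁻¹∘σ (j , 0F) = cong (_, 0F) (Fin.opposite-involutive j)
    σ⁻¹∘σ (j , 1F) = refl
    σ⁻¹∘σ (j , 2F) = cong (_, 2F) (Fin.opposite-involutive j)
    σ⁻¹∘σ (j , 3F) = refl
    σ⁻¹∘σ (j , 4F) = refl
    σ⁻¹∘σ (j , 5F) = cong (_, 5F) (Fin.opposite-involutive j)
    σ⁻¹∘σ (j , 6F) = cong (_, 6F) (Fin.opposite-involutive j)
    σ⁻¹∘σ (j , 7F) = refl
    σ⁻¹∘σ (j , 8F) = cong (_, 8F) (Fin.opposite-involutive j)
    σ⁻¹∘σ (j , 9F) = refl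

  -- Edge t of block j gets the label 1 + 2N c + w, where (c , h , x) = σ (j , t) and w encodes
  -- (h , x) within slot c stacked (N h + x) or interleaved (2 x + h). With a = j and b = N - 1 - j,
  -- the edges ab, bc, de, eg, ya, yc, ye, zd, zg, zb get 2N+2b+2, N+a+1, b+1, 4N+2a+2, 4N+2a+1,
  -- 6N+b+1, 8N+b+1, 7N+a+1, 2N+2b+1, 9N+a+1.
  edgeSlot : (Fin N × Fin 10) ↔ (Fin 5 × Fin 2 × Fin N)
  edgeSlot = mk↔ₛ′ σ σ⁻¹ σ∘σ⁻¹ σ⁻¹∘σ

  slotEncoding : Fin 5 → (Fin 2 × Fin N) ↔ Fin (2 * N)
  slotEncoding 1F = interleaving
  slotEncoding 2F = interleaving
  slotEncoding _  = stacking

  encodingValue : Fin 5 → Fin 2 → ℕ → ℕ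
  encodingValue 1F h x = 2 * x + toℕ h
  encodingValue 2F h x = 2 * x + toℕ h
  encodingValue _  h x = N * toℕ h + x

  toℕ-slotEncoding : ∀ c h x → toℕ (Inverse.to (slotEncoding c) (h , x)) ≡ encodingValue c h (toℕ x)
  toℕ-slotEncoding 0F = toℕ-stacking
  toℕ-slotEncoding 1F = toℕ-interleaving
  toℕ-slotEncoding 2F = toℕ-interleaving
  toℕ-slotEncoding 3F = toℕ-stacking
  toℕ-slotEncoding 4F = toℕ-stacking

  labelling : Labeling (rDF r s)
  labelling = cast-id (trans (5*[2*N]≡N*10 N) (numEdges-tabulate rDF-tabulate))
          ↔-∘ (combine-↔ slotEncoding
          ↔-∘ (edgeSlot
          ↔-∘ (Fin.*↔×
          ↔-∘ cast-id (sym (numEdges-tabulate rDF-tabulate)))))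
    where
    5*[2*N]≡N*10 : ∀ n → 5 * (2 * n) ≡ n * 10
    5*[2*N]≡N*10 = solve-∀

  blockLabel : Fin N → Fin 10 → ℕ
  blockLabel j t = let (c , h , x) = σ (j , t) in suc (2 * N * toℕ c + encodingValue c h (toℕ x))

  open VertexSums labelling

  ℓ-labelling : ∀ k i t → ℓ k i t ≡ blockLabel (combine k i) t
  ℓ-labelling k i t = cong suc (begin
    toℕ (labelling ⟨$⟩ʳ edgeIndex k i t)                         ≡⟨ Fin.toℕ-cast _ _ ⟩
    toℕ (Φ (σ (remQuot 10 (cast (sym eq) (edgeIndex k i t)))))    ≡⟨ cong (λ y → toℕ (Φ (σ (remQuot 10 y))))
                                                                       (Fin.cast-involutive (sym eq) eq (combine j t)) ⟩
    toℕ (Φ (σ (remQuot 10 (combine j t))))                        ≡⟨ cong (toℕ ∘ Φ ∘ σ) (Fin.remQuot-combine j t) ⟩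
    toℕ (Φ (σ (j , t)))                                           ≡⟨ toℕ-combine-↔ slotEncoding c (h , x) ⟩
    2 * N * toℕ c + toℕ (Inverse.to (slotEncoding c) (h , x))     ≡⟨ cong (2 * N * toℕ c +_) (toℕ-slotEncoding c h x) ⟩
    2 * N * toℕ c + encodingValue c h (toℕ x)                     ∎)
    where
    open ≡-Reasoning
    eq : r * s * 10 ≡ numEdges (rDF r s)
    eq = numEdges-tabulate rDF-tabulate
    j : Fin N
    j = combine k i
    Φ : Fin 5 × Fin 2 × Fin N → Fin (5 * (2 * N))
    Φ = Inverse.to (combine-↔ slotEncoding)
    c : Fin 5
    c = proj₁ (σ (j , t))
    h : Fin 2
    h = proj₁ (proj₂ (σ (j , t)))
    x : Fin N
    x = proj₂ (proj₂ (σ (j , t)))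

  blockColour : Fin 8 → ℕ
  blockColour 0F = 8 * N + 1
  blockColour 1F = 14 * N + 2
  blockColour 2F = 8 * N + 1
  blockColour 3F = 8 * N + 1
  blockColour 4F = 14 * N + 2
  blockColour 5F = 8 * N + 1
  blockColour 6F = 20 * N + 1
  blockColour 7F = 20 * N + 1

  colour : Fin 8 → ℕ
  colour 6F = s * blockColour 6F
  colour 7F = s * blockColour 7F
  colour x  = blockColour x

  localSum-blockLabel : ∀ j x → localSum (blockLabel j) x ≡ blockColour x
  localSum-blockLabel j 0F = a-sum N (toℕ j) (toℕ (opposite j)) (opposite-sum j)
  localSum-blockLabel j 1F = b-sum N (toℕ j) (toℕ (opposite j)) (opposite-sum j)
  localSum-blockLabel j 2F = c-sum N (toℕ j) (toℕ (opposite j)) (opposite-sum j)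
  localSum-blockLabel j 3F = d-sum N (toℕ j) (toℕ (opposite j)) (opposite-sum j)
  localSum-blockLabel j 4F = e-sum N (toℕ j) (toℕ (opposite j)) (opposite-sum j)
  localSum-blockLabel j 5F = g-sum N (toℕ j) (toℕ (opposite j)) (opposite-sum j)
  localSum-blockLabel j 6F = y-sum N (toℕ j) (toℕ (opposite j)) (opposite-sum j)
  localSum-blockLabel j 7F = z-sum N (toℕ j) (toℕ (opposite j)) (opposite-sum j)

  localSum-labelling : ∀ k i x → localSum (ℓ k i) x ≡ blockColour x
  localSum-labelling k i x = trans (sum-cong-≗ (λ t → cong (λ l → if isEnd x t then l else 0) (ℓ-labelling k i t)))
                                   (localSum-blockLabel (combine k i) x)

  vsum-labelling : ∀ k i x → vsum (rDF r s) labelling (vertex k i x) ≡ colour x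
  vsum-labelling k i 0F = trans (vsum-path k i 0F (<ᵇ⇒< _ _ _)) (localSum-labelling k i 0F)
  vsum-labelling k i 1F = trans (vsum-path k i 1F (<ᵇ⇒< _ _ _)) (localSum-labelling k i 1F)
  vsum-labelling k i 2F = trans (vsum-path k i 2F (<ᵇ⇒< _ _ _)) (localSum-labelling k i 2F)
  vsum-labelling k i 3F = trans (vsum-path k i 3F (<ᵇ⇒< _ _ _)) (localSum-labelling k i 3F)
  vsum-labelling k i 4F = trans (vsum-path k i 4F (<ᵇ⇒< _ _ _)) (localSum-labelling k i 4F)
  vsum-labelling k i 5F = trans (vsum-path k i 5F (<ᵇ⇒< _ _ _)) (localSum-labelling k i 5F)
  vsum-labelling k i 6F = trans (vsum-hub k i 6F ≤-refl) (∑-const _ (λ i' → localSum-labelling k i' 6F))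
  vsum-labelling k i 7F = trans (vsum-hub k i 7F (n≤1+n 6)) (∑-const _ (λ i' → localSum-labelling k i' 7F))

  module _ (r≥1 : 1 ≤ r) (s≥1 : 1 ≤ s) where

    P<Q : 8 * N + 1 < 14 * N + 2
    P<Q = 8n+1<14n+2 N

    Q<W : 14 * N + 2 < s * (20 * N + 1)
    Q<W = 14n+2<s[20n+1] (*-mono-≤ r≥1 s≥1) s≥1

    P<W : 8 * N + 1 < s * (20 * N + 1)
    P<W = <-trans P<Q Q<W

    colour-proper : ∀ t → colour (end₁ t) ≢ colour (end₂ t)
    colour-proper 0F = <⇒≢ P<Q
    colour-proper 1F = >⇒≢ P<Q
    colour-proper 2F = <⇒≢ P<Q
    colour-proper 3F = >⇒≢ P<Q
    colour-proper 4F = >⇒≢ P<W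
    colour-proper 5F = >⇒≢ P<W
    colour-proper 6F = >⇒≢ Q<W
    colour-proper 7F = >⇒≢ P<W
    colour-proper 8F = >⇒≢ P<W
    colour-proper 9F = >⇒≢ Q<W

    labelling-antimagic : IsLocalAntimagic (rDF r s) labelling
    labelling-antimagic = All⇒IsLocalAntimagic (rDF r s) labelling (All-edges proper)
      where
      proper : ∀ k i t → vsum (rDF r s) labelling (proj₁ (edge k i t)) ≢ vsum (rDF r s) labelling (proj₂ (edge k i t))
      proper k i t eq =
        colour-proper t (trans (sym (vsum-labelling k i (end₁ t))) (trans eq (vsum-labelling k i (end₂ t))))

    colours : List ℕ
    colours = 8 * N + 1 ∷ 14 * N + 2 ∷ s * (20 * N + 1) ∷ []

    colour-∈ : ∀ x → colour x ∈ colours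
    colour-∈ 0F = here refl
    colour-∈ 1F = there (here refl)
    colour-∈ 2F = here refl
    colour-∈ 3F = here refl
    colour-∈ 4F = there (here refl)
    colour-∈ 5F = here refl
    colour-∈ 6F = there (there (here refl))
    colour-∈ 7F = there (there (here refl))

    numColours-labelling : numColours (rDF r s) labelling ≡ 3
    numColours-labelling = ≤-antisym
      (numColours≤ (rDF r s) labelling colours
        (All-vertices (All-edges (λ k i t → vsum-∈ k i (end₁ t) , vsum-∈ k i (end₂ t)))))
      (LowerBound.numColours≥3 r s labelling labelling-antimagic (fromℕ< r≥1) (fromℕ< s≥1))
      where
      vsum-∈ : ∀ k i x → vsum (rDF r s) labelling (vertex k i x) ∈ colours
      vsum-∈ k i x = subst (_∈ colours) (sym (vsum-labelling k i x)) (colour-∈ x)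

theorem2p6 : ∀ (r s : ℕ) → 1 ≤ r → 1 ≤ s → χla≡ (rDF r s) 3
theorem2p6 r s r≥1 s≥1 =
  (labelling , labelling-antimagic r≥1 s≥1 , numColours-labelling r≥1 s≥1) ,
  λ π antimagic → LowerBound.numColours≥3 r s π antimagic (fromℕ< r≥1) (fromℕ< s≥1)
  where open UpperBound r s
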